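{- A countably infinite structure $G$ in a finite relational language is strongly online categorical if and only if it is homogeneous.
   Context: A presentation of $G$ is an isomorphic copy of $G$ with domain $\mathbb{N}$, coded as an infinite string $\alpha$ whose initial segment $\alpha\upharpoonright i$ describes the finite induced substructure on the first $i$ elements. $G$ is strongly online categorical if there is a primitive recursive function $F$ of three arguments $(\sigma,\tau,i)$, where $\sigma,\tau$ are finite strings of length $i$ describing finite structures, such that for any two presentations $\alpha,\beta$ of $G$ the map sending the $i$-th element of $\alpha$ to the element of $\beta$ given by $F(\alpha\upharpoonright i,\beta\upharpoonright i,i)$ (an element among the first $i$ elements of $\beta$) is an isomorphism from $\alpha$ onto $\beta$ (i.e. a strict online functional with both uses equal to the identity). $G$ is homogeneous if for any finite tuple $\bar x$ of elements of $G$ and any elements $y,z\in G$ not in $\bar x$, there is an automorphism of $G$ fixing $\bar x$ pointwise and mapping $y$ to $z$. -}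

module Defs where

open import Data.Nat using (ℕ; zero; suc; _+_; _*_; _<_)
open import Data.Fin using (Fin)
open import Data.Vec using (Vec; []; _∷_; lookup; tabulate)
import Data.Vec as V
open import Data.List using (List; []; _∷_; concatMap; map; upTo; foldr)
open import Data.List.Base using (allFin)
open import Data.Bool using (Bool; true; false; if_then_else_)
open import Data.Product using (Σ; _×_; ∃)
open import Relation.Binary.PropositionalEquality using (_≡_; _≢_)
open import Function.Definitions using (Bijective)

record Language : Set where
  field
    nsym  : ℕ
    arity : Fin nsym → ℕ
open Language public

record Structure (L : Language) (A : Set) : Set where
  field
    rel : (r : Fin (nsym L)) → Vec A (arity L r) → Bool
open Structure public

-- Isomorphism between structures: bijection preserving all relations (both ways, since Bool-valued).
IsIso : {L : Language} {A B : Set} → Structure L A → Structure L B → (A → B) → Set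
IsIso {L} M N f =
  Bijective _≡_ _≡_ f ×
  ((r : Fin (nsym L)) (t : Vec _ (arity L r)) → rel M r t ≡ rel N r (V.map f t))

IsAut : {L : Language} {A : Set} → Structure L A → (A → A) → Set
IsAut M f = IsIso M M f

IsPresentation : {L : Language} {A : Set} → Structure L A → Structure L ℕ → Set
IsPresentation G α = Σ (_ → ℕ) (IsIso G α)

Homogeneous : {L : Language} {A : Set} → Structure L A → Set
Homogeneous {L} {A} G =
  (k : ℕ) (xs : Vec A k) (y z : A) →
  ((j : Fin k) → lookup xs j ≢ y) →
  ((j : Fin k) → lookup xs j ≢ z) →
  Σ (A → A) λ h → IsAut G h × ((j : Fin k) → h (lookup xs j) ≡ lookup xs j) × (h y ≡ z)

data PR : ℕ → Set where
  pr-zero : {n : ℕ} → PR n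
  pr-succ : PR 1
  pr-proj : {n : ℕ} → Fin n → PR n
  pr-comp : {n m : ℕ} → PR m → (Fin m → PR n) → PR n
  pr-rec  : {n : ℕ} → PR n → PR (suc (suc n)) → PR (suc n)

eval : {n : ℕ} → PR n → Vec ℕ n → ℕ
eval pr-zero xs = 0
eval pr-succ (x ∷ []) = suc x
eval (pr-proj i) xs = lookup xs i
eval (pr-comp f gs) xs = eval f (tabulate (λ j → eval (gs j) xs))
eval (pr-rec f g) (zero ∷ xs) = eval f xs
eval (pr-rec f g) (suc k ∷ xs) = eval g (k ∷ eval (pr-rec f g) (k ∷ xs) ∷ xs)

tuples : (k i : ℕ) → List (Vec ℕ k)
tuples zero i = [] ∷ []
tuples (suc k) i = concatMap (λ j → map (j ∷_) (tuples k i)) (upTo i)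

-- the atomic diagram of the substructure on the first i elements, as a bit string:
-- for each relation symbol in order, the truth values on all tuples from {0,…,i-1}
diagram : {L : Language} → Structure L ℕ → ℕ → List Bool
diagram {L} α i = concatMap (λ r → map (rel α r) (tuples (arity L r) i)) (allFin (nsym L))

-- bit string read as a binary numeral (first bit least significant)
bitsToℕ : List Bool → ℕ
bitsToℕ = foldr (λ b acc → (if b then 1 else 0) + 2 * acc) 0

restrict : {L : Language} → Structure L ℕ → ℕ → ℕ
restrict α i = bitsToℕ (diagram α i)

-- The map induced by F on presentations α, β: the element m (the (m+1)-th element) of α
-- is sent to F(α↾(m+1), β↾(m+1), m+1).
onlineMap : {L : Language} → PR 3 → Structure L ℕ → Structure L ℕ → ℕ → ℕ
onlineMap F α β m = eval F (restrict α (suc m) ∷ restrict β (suc m) ∷ suc m ∷ [])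

StronglyOnlineCategorical : {L : Language} {A : Set} → Structure L A → Set
StronglyOnlineCategorical G =
  Σ (PR 3) λ F →
    (α β : Structure _ ℕ) → IsPresentation G α → IsPresentation G β →
    ((m : ℕ) → onlineMap F α β m < suc m) × IsIso α β (onlineMap F α β)

-- Both properties turn out to be
-- equivalent to G being *fully symmetric*: every permutation of G is an
-- automorphism, i.e. the truth of a relation on a tuple depends only on which
-- entries of the tuple are equal.
--
-- On a type with
--    decidable equality, a predicate Q on tuples that is invariant under
--    replacing a point by a point not occurring in the tuple is invariant under
--    every injective renaming with fresh image (rename the points one at a
--    time); if the type is enumerated by ℕ, fresh points always exist, and Q is
--    then invariant under every permutation.
--  * Homogeneous ⇔ fully symmetric.  Homogeneity yields exactly the
--    replacement invariance above; conversely a transposition of y and z is an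
--    automorphism fixing everything else.
--  * Strongly online categorical ⇔ fully symmetric, through the intermediate
--    notion "any two presentations have the same relations".  An online map is
--    injective and sends m to at most m, hence is the identity; comparing the
--    presentations of G obtained by enumerating it as e and as π ∘ e shows that
--    π is an automorphism.  Conversely, for a fully symmetric G the identity is
--    an isomorphism between presentations, and it is computed online by i ↦ i ∸ 1.
module Submission where

open import Defs
open import Data.Nat using (ℕ)
open import Data.Product using (_×_)
open import Function.Bundles using (_⤖_)

open import Data.Nat using (suc; _+_; _<_; _≤_; s≤s)
open import Data.Nat.Properties
  using (m<1+n⇒m<n∨m≡n; <⇒≢; <-≤-trans; ≤-trans; ≤-refl; ≤-reflexive; m≤m+n; m≤n+m; +-cancelˡ-≡)
  renaming (_≟_ to _≟ℕ_)
open import Data.Nat.Induction using (<-rec)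
open import Data.Fin using (Fin) renaming (zero to fzero; suc to fsuc)
open import Data.Vec using (Vec; []; _∷_; map; lookup)
open import Data.Vec.Properties using (map-cong; map-id; map-∘)
open import Data.Vec.Relation.Unary.Any using (here; there; index)
open import Data.Vec.Relation.Unary.Any.Properties using (lookup-index) renaming (map⁻ to Any-map⁻)
open import Data.Vec.Membership.Propositional using (_∈_; _∉_; find)
open import Data.Vec.Membership.Propositional.Properties using (∈-lookup; ∈-map⁺)
import Data.Vec.Membership.DecPropositional as DecMembership
open import Data.Product using (∃; _,_)
open import Data.Sum using (_⊎_; inj₁; inj₂)
open import Function using (_∘_)
open import Function.Bundles using (_↔_; Inverse; mk⤖; mk↔ₛ′; module Bijection)
open import Function.Definitions using (Injective)
open import Function.Construct.Composition using (_↔-∘_)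
open import Function.Construct.Symmetry using (↔-sym)
open import Function.Properties.Bijection using (⤖⇒↔)
open import Function.Properties.Inverse using (↔⇒⤖)
open import Relation.Binary.Definitions using (DecidableEquality)
open import Relation.Binary.PropositionalEquality using (_≡_; _≢_; _≗_; refl; sym; trans; cong; cong₂; subst; module ≡-Reasoning)
open import Relation.Nullary using (Dec; yes; no; contradiction)
open import Relation.Nullary.Decidable using (map′)

open Inverse using (to; from; strictlyInverseˡ; strictlyInverseʳ)

private
  variable
    A B C : Set
    k n : ℕ

map-cong-∈ : {f g : A → B} (t : Vec A n) → (∀ {x} → x ∈ t → f x ≡ g x) → map f t ≡ map g t
map-cong-∈ [] _ = refl
map-cong-∈ (x ∷ t) f≗g = cong₂ _∷_ (f≗g (here refl)) (map-cong-∈ t (f≗g ∘ there))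

∈-map⁻ : (f : A → B) {y : B} (t : Vec A n) → y ∈ map f t → ∃ λ x → x ∈ t × y ≡ f x
∈-map⁻ f t y∈ft = find (Any-map⁻ y∈ft)

∉⇒lookup-≢ : {xs : Vec A n} {y : A} → y ∉ xs → (j : Fin n) → lookup xs j ≢ y
∉⇒lookup-≢ {xs = xs} y∉xs j eq = y∉xs (subst (_∈ xs) eq (∈-lookup j xs))

fixes-lookups⇒fixes-∈ : {xs : Vec A n} {h : A → A} →
                        ((j : Fin n) → h (lookup xs j) ≡ lookup xs j) → ∀ {x} → x ∈ xs → h x ≡ x
fixes-lookups⇒fixes-∈ {h = h} h-fixes x∈xs = subst (λ x → h x ≡ x) (sym (lookup-index x∈xs)) (h-fixes (index x∈xs))

map-from-to : (π : A ↔ B) (t : Vec A n) → map (from π) (map (to π) t) ≡ t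
map-from-to π t = trans (sym (map-∘ (from π) (to π) t)) (trans (map-cong (strictlyInverseʳ π) t) (map-id t))

map-to-from : (π : A ↔ B) (t : Vec B n) → map (to π) (map (from π) t) ≡ t
map-to-from π t = map-from-to (↔-sym π) t

PermutationInvariant : (Vec A n → C) → Set
PermutationInvariant {A = A} {n = n} Q = (π : A ↔ A) (t : Vec A n) → Q t ≡ Q (map (to π) t)

module PointMaps {A : Set} (_≟_ : DecidableEquality A) where

  replace : A → A → A → A
  replace a b x with x ≟ a
  ... | yes _ = b
  ... | no _ = x

  replace-target : (a b : A) → replace a b a ≡ b
  replace-target a b with a ≟ a
  ... | yes _ = refl
  ... | no a≢a = contradiction refl a≢a

  replace-other : {a b x : A} → x ≢ a → replace a b x ≡ x
  replace-other {a} {x = x} x≢a with x ≟ a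
  ... | yes x≡a = contradiction x≡a x≢a
  ... | no _ = refl

  ∈-replace⁻ : {a b c : A} (t : Vec A n) → c ∈ map (replace a b) t → c ≡ b ⊎ (c ≢ a × c ∈ t)
  ∈-replace⁻ {a = a} {b} {c} t c∈ with ∈-map⁻ (replace a b) t c∈
  ... | x , x∈t , c≡ = by-cases (x ≟ a)
    where
    by-cases : Dec (x ≡ a) → c ≡ b ⊎ (c ≢ a × c ∈ t)
    by-cases (yes refl) = inj₁ (trans c≡ (replace-target x b))
    by-cases (no x≢a) = inj₂ (c≢a , subst (_∈ t) (sym c≡x) x∈t)
      where
      c≡x : c ≡ x
      c≡x = trans c≡ (replace-other x≢a)
      c≢a : c ≢ a
      c≢a c≡a = x≢a (trans (sym c≡x) c≡a)

  replace-absent : {a b : A} (t : Vec A n) → a ∉ t → map (replace a b) t ≡ t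
  replace-absent t a∉t =
    trans (map-cong-∈ t (λ x∈t → replace-other (λ x≡a → a∉t (subst (_∈ t) x≡a x∈t)))) (map-id t)

  ReplaceInvariant : (Vec A n → C) → Set
  ReplaceInvariant Q = ∀ t a b → b ∉ t → Q t ≡ Q (map (replace a b) t)

  swap : A → A → A → A
  swap y z x with x ≟ y
  ... | yes _ = z
  ... | no _ = replace z y x

  swap-left : (y z : A) → swap y z y ≡ z
  swap-left y z with y ≟ y
  ... | yes _ = refl
  ... | no y≢y = contradiction refl y≢y

  swap-right : (y z : A) → swap y z z ≡ y
  swap-right y z with z ≟ y
  ... | yes z≡y = z≡y
  ... | no _ = replace-target z y

  swap-other : {y z x : A} → x ≢ y → x ≢ z → swap y z x ≡ x
  swap-other {y} {x = x} x≢y x≢z with x ≟ y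
  ... | yes x≡y = contradiction x≡y x≢y
  ... | no _ = replace-other x≢z

  swap-involutive : (y z x : A) → swap y z (swap y z x) ≡ x
  swap-involutive y z x = by-cases (x ≟ y) (x ≟ z)
    where
    by-cases : Dec (x ≡ y) → Dec (x ≡ z) → swap y z (swap y z x) ≡ x
    by-cases (yes refl) _ = trans (cong (swap x z) (swap-left x z)) (swap-right x z)
    by-cases (no _) (yes refl) = trans (cong (swap y x) (swap-right y x)) (swap-left y x)
    by-cases (no x≢y) (no x≢z) = trans (cong (swap y z) (swap-other x≢y x≢z)) (swap-other x≢y x≢z)

  transposition : A → A → A ↔ A
  transposition y z = mk↔ₛ′ (swap y z) (swap y z) (swap-involutive y z) (swap-involutive y z)

-- Renaming the points of a tuple one at a time.  Passing from ps to p ∷ ps amounts to replacing p by φ p,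
-- and in  map (renameOn ps) t  either φ p is fresh (p ∉ ps) or p no longer occurs
-- (p ∈ ps); so a replacement invariant Q is unchanged at every step.
module FreshRenaming {A : Set} (_≟_ : DecidableEquality A)
                     {C : Set} (Q : Vec A n → C) (Q-invariant : PointMaps.ReplaceInvariant _≟_ Q)
                     (φ : A → A) (φ-injective : Injective _≡_ _≡_ φ)
                     (t : Vec A n) (φ-fresh : ∀ a → φ a ∉ t) where

  open PointMaps _≟_
  open DecMembership _≟_ using (_∈?_)

  renameOn : Vec A k → A → A
  renameOn ps x with x ∈? ps
  ... | yes _ = φ x
  ... | no _ = x

  renameOn-∈ : (ps : Vec A k) {x : A} → x ∈ ps → renameOn ps x ≡ φ x
  renameOn-∈ ps {x} x∈ps with x ∈? ps
  ... | yes _ = refl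
  ... | no x∉ps = contradiction x∈ps x∉ps

  renameOn-∉ : (ps : Vec A k) {x : A} → x ∉ ps → renameOn ps x ≡ x
  renameOn-∉ ps {x} x∉ps with x ∈? ps
  ... | yes x∈ps = contradiction x∈ps x∉ps
  ... | no _ = refl

  renameOn-cons : (p : A) (ps : Vec A k) → (∀ a → φ a ≢ p) →
                  replace p (φ p) ∘ renameOn ps ≗ renameOn (p ∷ ps)
  renameOn-cons p ps p∉φ x = by-cases (x ∈? ps) (x ≟ p)
    where
    by-cases : Dec (x ∈ ps) → Dec (x ≡ p) → replace p (φ p) (renameOn ps x) ≡ renameOn (p ∷ ps) x
    by-cases (yes x∈ps) _ = begin
      replace p (φ p) (renameOn ps x) ≡⟨ cong (replace p (φ p)) (renameOn-∈ ps x∈ps) ⟩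
      replace p (φ p) (φ x)           ≡⟨ replace-other (p∉φ x) ⟩
      φ x                             ≡⟨ renameOn-∈ (p ∷ ps) (there x∈ps) ⟨
      renameOn (p ∷ ps) x             ∎
      where open ≡-Reasoning
    by-cases (no x∉ps) (yes refl) = begin
      replace x (φ x) (renameOn ps x) ≡⟨ cong (replace x (φ x)) (renameOn-∉ ps x∉ps) ⟩
      replace x (φ x) x               ≡⟨ replace-target x (φ x) ⟩
      φ x                             ≡⟨ renameOn-∈ (x ∷ ps) (here refl) ⟨
      renameOn (x ∷ ps) x             ∎
      where open ≡-Reasoning
    by-cases (no x∉ps) (no x≢p) = begin
      replace p (φ p) (renameOn ps x) ≡⟨ cong (replace p (φ p)) (renameOn-∉ ps x∉ps) ⟩
      replace p (φ p) x               ≡⟨ replace-other x≢p ⟩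
      x                               ≡⟨ renameOn-∉ (p ∷ ps) x∉p∷ps ⟨
      renameOn (p ∷ ps) x             ∎
      where
      open ≡-Reasoning
      x∉p∷ps : x ∉ p ∷ ps
      x∉p∷ps (here x≡p) = x≢p x≡p
      x∉p∷ps (there x∈ps) = x∉ps x∈ps

  ∈-renamed⁻ : (ps : Vec A k) {c : A} → c ∈ map (renameOn ps) t →
               (∃ λ a → a ∈ ps × c ≡ φ a) ⊎ (c ∉ ps × c ∈ t)
  ∈-renamed⁻ ps {c} c∈ with ∈-map⁻ (renameOn ps) t c∈
  ... | x , x∈t , c≡ = by-cases (x ∈? ps)
    where
    by-cases : Dec (x ∈ ps) → (∃ λ a → a ∈ ps × c ≡ φ a) ⊎ (c ∉ ps × c ∈ t)
    by-cases (yes x∈ps) = inj₁ (x , x∈ps , trans c≡ (renameOn-∈ ps x∈ps))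
    by-cases (no x∉ps) = inj₂ (subst (_∉ ps) (sym c≡x) x∉ps , subst (_∈ t) (sym c≡x) x∈t)
      where
      c≡x : c ≡ x
      c≡x = trans c≡ (renameOn-∉ ps x∉ps)

  replace-step : (p : A) (ps : Vec A k) → (∀ a → φ a ∉ ps) →
                 Q (map (renameOn ps) t) ≡ Q (map (replace p (φ p)) (map (renameOn ps) t))
  replace-step p ps φ∉ps with p ∈? ps
  ... | yes p∈ps = cong Q (sym (replace-absent _ p-absent))
    where
    p-absent : p ∉ map (renameOn ps) t
    p-absent p∈ with ∈-renamed⁻ ps p∈
    ... | inj₁ (a , _ , p≡φa) = φ∉ps a (subst (_∈ ps) p≡φa p∈ps)
    ... | inj₂ (p∉ps , _) = p∉ps p∈ps
  ... | no p∉ps = Q-invariant _ p (φ p) φp-fresh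
    where
    φp-fresh : φ p ∉ map (renameOn ps) t
    φp-fresh φp∈ with ∈-renamed⁻ ps φp∈
    ... | inj₁ (a , a∈ps , φp≡φa) = p∉ps (subst (_∈ ps) (sym (φ-injective φp≡φa)) a∈ps)
    ... | inj₂ (_ , φp∈t) = φ-fresh p φp∈t

  rename-prefix : (ps : Vec A k) → (∀ a → φ a ∉ ps) → Q t ≡ Q (map (renameOn ps) t)
  rename-prefix [] _ = cong Q (sym (trans (map-cong (λ x → renameOn-∉ [] (λ ())) t) (map-id t)))
  rename-prefix (p ∷ ps) φ∉p∷ps = begin
    Q t                                          ≡⟨ rename-prefix ps φ∉ps ⟩
    Q (map (renameOn ps) t)                      ≡⟨ replace-step p ps φ∉ps ⟩
    Q (map (replace p (φ p)) (map (renameOn ps) t)) ≡⟨ cong Q (sym (map-∘ _ _ t)) ⟩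
    Q (map (replace p (φ p) ∘ renameOn ps) t)    ≡⟨ cong Q (map-cong (renameOn-cons p ps φ≢p) t) ⟩
    Q (map (renameOn (p ∷ ps)) t)                ∎
    where
    open ≡-Reasoning
    φ∉ps : ∀ a → φ a ∉ ps
    φ∉ps a = φ∉p∷ps a ∘ there
    φ≢p : ∀ a → φ a ≢ p
    φ≢p a = φ∉p∷ps a ∘ here

  rename-fresh : Q t ≡ Q (map φ t)
  rename-fresh = trans (rename-prefix t φ-fresh) (cong Q (map-cong-∈ t (renameOn-∈ t)))

module Enumerated {A : Set} (enum : ℕ ↔ A) where

  element : ℕ → A
  element = to enum

  code : A → ℕ
  code = from enum

  code-injective : Injective _≡_ _≡_ code
  code-injective {x} {y} eq = trans (sym (strictlyInverseˡ enum x)) (trans (cong element eq) (strictlyInverseˡ enum y))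

  _≟_ : DecidableEquality A
  x ≟ y = map′ code-injective (cong code) (code x ≟ℕ code y)

  open PointMaps _≟_ public

  bound : Vec A n → ℕ
  bound [] = 0
  bound (x ∷ t) = suc (code x) + bound t

  code<bound : (t : Vec A n) {x : A} → x ∈ t → code x < bound t
  code<bound (y ∷ t) (here refl) = s≤s (m≤m+n (code y) (bound t))
  code<bound (y ∷ t) (there x∈t) = <-≤-trans (code<bound t x∈t) (m≤n+m (bound t) (suc (code y)))

  beyond-bound : (t : Vec A n) {x : A} → bound t ≤ code x → x ∉ t
  beyond-bound t t≤x x∈t = <⇒≢ (<-≤-trans (code<bound t x∈t) t≤x) refl

  fresh : Vec A n → A
  fresh t = element (bound t)

  fresh-∉ : (t : Vec A n) → fresh t ∉ t
  fresh-∉ t = beyond-bound t (≤-reflexive (sym (strictlyInverseʳ enum (bound t))))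

  shift : ℕ → A → A
  shift k x = element (k + code x)

  shift-injective : (k : ℕ) → Injective _≡_ _≡_ (shift k)
  shift-injective k eq = code-injective (+-cancelˡ-≡ k _ _ (trans (sym (strictlyInverseʳ enum _))
                                                                (trans (cong code eq) (strictlyInverseʳ enum _))))

  shift-fresh : (t : Vec A n) {k : ℕ} → bound t ≤ k → ∀ x → shift k x ∉ t
  shift-fresh t {k} t≤k x = beyond-bound t (≤-trans (≤-trans t≤k (m≤m+n k (code x)))
                                                     (≤-reflexive (sym (strictlyInverseʳ enum (k + code x)))))

  -- Replacement invariance implies permutation invariance: φ = shift offset and
  -- ψ = φ ∘ π⁻¹ are injective with values fresh for t and π t respectively, and
  -- they send t and π t to the same tuple.
  replace⇒permutation-invariant : {Q : Vec A n → C} → ReplaceInvariant Q → PermutationInvariant Q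
  replace⇒permutation-invariant {Q = Q} Q-invariant π t = begin
    Q t                              ≡⟨ FreshRenaming.rename-fresh _≟_ Q Q-invariant φ (shift-injective offset)
                                          t (shift-fresh t (m≤m+n _ _)) ⟩
    Q (map φ t)                      ≡⟨ cong Q same-tuple ⟨
    Q (map ψ (map (to π) t))         ≡⟨ FreshRenaming.rename-fresh _≟_ Q Q-invariant ψ ψ-injective
                                          (map (to π) t) (λ x → shift-fresh (map (to π) t) (m≤n+m _ _) (from π x)) ⟨
    Q (map (to π) t)                 ∎
    where
    open ≡-Reasoning
    offset : ℕ
    offset = bound t + bound (map (to π) t)
    φ : A → A
    φ = shift offset
    ψ : A → A
    ψ = φ ∘ from π
    ψ-injective : Injective _≡_ _≡_ ψ
    ψ-injective {x} {y} eq =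
      trans (sym (strictlyInverseˡ π x)) (trans (cong (to π) (shift-injective offset eq)) (strictlyInverseˡ π y))
    same-tuple : map ψ (map (to π) t) ≡ map φ t
    same-tuple = trans (sym (map-∘ ψ (to π) t)) (map-cong (cong φ ∘ strictlyInverseʳ π) t)

FullySymmetric : {L : Language} {A : Set} → Structure L A → Set
FullySymmetric {L} G = (r : Fin (nsym L)) → PermutationInvariant (rel G r)

PresentationsAgree : {L : Language} {A : Set} → Structure L A → Set
PresentationsAgree {L} G =
  (α β : Structure L ℕ) → IsPresentation G α → IsPresentation G β →
  (r : Fin (nsym L)) (t : Vec ℕ (arity L r)) → rel α r t ≡ rel β r t

-- An injective map of ℕ sending each m to at most m is the identity: if f m < m,
-- the induction hypothesis at f m gives f (f m) ≡ f m, hence f m ≡ m.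
bounded-injection-is-identity : (f : ℕ → ℕ) → Injective _≡_ _≡_ f → (∀ m → f m < suc m) → ∀ m → f m ≡ m
bounded-injection-is-identity f f-injective f-bounded = <-rec _ step
  where
  step : ∀ m → (∀ {j} → j < m → f j ≡ j) → f m ≡ m
  step m ih with m<1+n⇒m<n∨m≡n (f-bounded m)
  ... | inj₁ fm<m = contradiction (f-injective (ih fm<m)) (<⇒≢ fm<m)
  ... | inj₂ fm≡m = fm≡m

predecessor : PR 1
predecessor = pr-rec pr-zero (pr-proj fzero)

-- F(σ, τ, i) = i ∸ 1: the online algorithm sending the m-th element to the m-th element.
identity-online : PR 3
identity-online = pr-comp predecessor (λ _ → pr-proj (fsuc (fsuc fzero)))

module _ {L : Language} {A : Set} (G : Structure L A) where

  pullback : (ℕ → A) → Structure L ℕ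
  pullback e = record { rel = λ r t → rel G r (map e t) }

  pullback-presentation : (enum : ℕ ↔ A) → IsPresentation G (pullback (to enum))
  pullback-presentation enum =
    from enum , Bijection.bijective (↔⇒⤖ (↔-sym enum)) , λ r t → cong (rel G r) (sym (map-to-from enum t))

  decode : {α : Structure L ℕ} → IsPresentation G α → ℕ ↔ A
  decode (_ , f-bijective , _) = ↔-sym (⤖⇒↔ (mk⤖ f-bijective))

  presentation-rel : {α : Structure L ℕ} (p : IsPresentation G α) (r : Fin (nsym L)) (t : Vec ℕ (arity L r)) →
                     rel α r t ≡ rel G r (map (to (decode {α} p)) t)
  presentation-rel {α} p@(_ , _ , f-preserves) r t =
    sym (trans (f-preserves r _) (cong (rel α r) (map-from-to (decode {α} p) t)))

  AutomorphismFixing : Vec A k → A → A → Set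
  AutomorphismFixing xs y z = ∃ λ h → IsAut G h × (∀ {x} → x ∈ xs → h x ≡ x) × h y ≡ z

  homogeneous-∈ : Homogeneous G → (xs : Vec A k) {y z : A} → y ∉ xs → z ∉ xs → AutomorphismFixing xs y z
  homogeneous-∈ homogeneous xs y∉xs z∉xs with homogeneous _ xs _ _ (∉⇒lookup-≢ y∉xs) (∉⇒lookup-≢ z∉xs)
  ... | h , h-aut , h-fixes , h-moves = h , h-aut , fixes-lookups⇒fixes-∈ h-fixes , h-moves

  module _ (enum : ℕ ↔ A) where
    open Enumerated enum

    -- In a homogeneous structure, replacing a by a point b absent from t preserves
    -- the relations: with w a third point, the automorphism fixing  t[a := w]  and
    -- sending a to b acts on t as the replacement of a by b.
    homogeneous⇒replace-invariant : Homogeneous G → (r : Fin (nsym L)) → ReplaceInvariant (rel G r)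
    homogeneous⇒replace-invariant homogeneous r t a b b∉t =
      acts-as-replacement (homogeneous-∈ homogeneous (map (replace a w) t) a∉xs b∉xs)
      where
      w : A
      w = fresh (a ∷ b ∷ [])
      a∉xs : a ∉ map (replace a w) t
      a∉xs a∈ with ∈-replace⁻ t a∈
      ... | inj₁ a≡w = fresh-∉ (a ∷ b ∷ []) (here (sym a≡w))
      ... | inj₂ (a≢a , _) = a≢a refl
      b∉xs : b ∉ map (replace a w) t
      b∉xs b∈ with ∈-replace⁻ t b∈
      ... | inj₁ b≡w = fresh-∉ (a ∷ b ∷ []) (there (here (sym b≡w)))
      ... | inj₂ (_ , b∈t) = b∉t b∈t
      acts-as-replacement : AutomorphismFixing (map (replace a w) t) a b → rel G r t ≡ rel G r (map (replace a b) t)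
      acts-as-replacement (h , (_ , h-preserves) , h-fixes , h≡b) =
        trans (h-preserves r t) (cong (rel G r) (map-cong-∈ t h-replaces))
        where
        h-replaces : ∀ {x} → x ∈ t → h x ≡ replace a b x
        h-replaces {x} x∈t = by-cases (x ≟ a)
          where
          by-cases : Dec (x ≡ a) → h x ≡ replace a b x
          by-cases (yes refl) = trans h≡b (sym (replace-target x b))
          by-cases (no x≢a) = trans (h-fixes (subst (_∈ _) (replace-other x≢a) (∈-map⁺ (replace a w) x∈t)))
                                    (sym (replace-other x≢a))

    homogeneous⇒fully-symmetric : Homogeneous G → FullySymmetric G
    homogeneous⇒fully-symmetric homogeneous r = replace⇒permutation-invariant (homogeneous⇒replace-invariant homogeneous r)

    -- Compare the presentations of G given by the enumerations  to enum  and  π ∘ to enum.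
    presentations-agree⇒fully-symmetric : PresentationsAgree G → FullySymmetric G
    presentations-agree⇒fully-symmetric agree r π s = begin
      rel G r s                                ≡⟨ cong (rel G r) (map-to-from enum s) ⟨
      rel G r (map (to enum) (map code s))     ≡⟨ agree (pullback (to enum)) (pullback (to (π ↔-∘ enum)))
                                                    (pullback-presentation enum) (pullback-presentation (π ↔-∘ enum)) r (map code s) ⟩
      rel G r (map (to π ∘ to enum) (map code s)) ≡⟨ cong (rel G r) (map-∘ (to π) (to enum) (map code s)) ⟩
      rel G r (map (to π) (map (to enum) (map code s))) ≡⟨ cong (rel G r ∘ map (to π)) (map-to-from enum s) ⟩
      rel G r (map (to π) s)                   ∎
      where open ≡-Reasoning

  -- A transposition of y and z fixes every other point.
  fully-symmetric⇒homogeneous : DecidableEquality A → FullySymmetric G → Homogeneous G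
  fully-symmetric⇒homogeneous _≟_ symmetric _ xs y z xs≢y xs≢z =
    swap y z , (Bijection.bijective (↔⇒⤖ τ) , λ r → symmetric r τ) ,
    (λ j → swap-other (xs≢y j) (xs≢z j)) , swap-left y z
    where
    open PointMaps _≟_
    τ : A ↔ A
    τ = transposition y z

  -- By symmetry, the isomorphisms of G with any two presentations differ by an automorphism.
  fully-symmetric⇒presentations-agree : FullySymmetric G → PresentationsAgree G
  fully-symmetric⇒presentations-agree symmetric α β pα pβ r t = begin
    rel α r t                          ≡⟨ presentation-rel pα r t ⟩
    rel G r (map (to dα) t)            ≡⟨ symmetric r (dβ ↔-∘ ↔-sym dα) (map (to dα) t) ⟩
    rel G r (map (to dβ ∘ from dα) (map (to dα) t)) ≡⟨ cong (rel G r) (map-∘ (to dβ) (from dα) (map (to dα) t)) ⟩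
    rel G r (map (to dβ) (map (from dα) (map (to dα) t))) ≡⟨ cong (rel G r ∘ map (to dβ)) (map-from-to dα t) ⟩
    rel G r (map (to dβ) t)            ≡⟨ presentation-rel pβ r t ⟨
    rel β r t                          ∎
    where
    open ≡-Reasoning
    dα dβ : ℕ ↔ A
    dα = decode {α} pα
    dβ = decode {β} pβ

  -- The online map of a strongly online categorical structure is the identity, by
  -- bounded-injection-is-identity; so the identity is an isomorphism between presentations.
  online⇒presentations-agree : StronglyOnlineCategorical G → PresentationsAgree G
  online⇒presentations-agree (F , online) α β pα pβ r t with online α β pα pβ
  ... | f-bounded , (f-injective , _) , f-preserves = begin
    rel α r t                          ≡⟨ f-preserves r t ⟩
    rel β r (map (onlineMap F α β) t)  ≡⟨ cong (rel β r) (map-cong f≗id t) ⟩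
    rel β r (map (λ m → m) t)          ≡⟨ cong (rel β r) (map-id t) ⟩
    rel β r t                          ∎
    where
    open ≡-Reasoning
    f≗id : onlineMap F α β ≗ λ m → m
    f≗id = bounded-injection-is-identity (onlineMap F α β) f-injective f-bounded

  presentations-agree⇒online : PresentationsAgree G → StronglyOnlineCategorical G
  presentations-agree⇒online agree = identity-online , λ α β pα pβ →
    (λ _ → ≤-refl) , ((λ eq → eq) , λ m → m , λ eq → eq) ,
    λ r t → trans (agree α β pα pβ r t) (cong (rel β r) (sym (map-id t)))

theorem4p9 : (L : Language) (A : Set) (G : Structure L A) → (ℕ ⤖ A) →
    (StronglyOnlineCategorical G → Homogeneous G) × (Homogeneous G → StronglyOnlineCategorical G)
theorem4p9 L A G enumeration = online⇒homogeneous , homogeneous⇒online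
  where
  enum : ℕ ↔ A
  enum = ⤖⇒↔ enumeration
  online⇒homogeneous : StronglyOnlineCategorical G → Homogeneous G
  online⇒homogeneous = fully-symmetric⇒homogeneous G (Enumerated._≟_ enum)
                     ∘ presentations-agree⇒fully-symmetric G enum
                     ∘ online⇒presentations-agree G
  homogeneous⇒online : Homogeneous G → StronglyOnlineCategorical G
  homogeneous⇒online = presentations-agree⇒online G
                     ∘ fully-symmetric⇒presentations-agree G
                     ∘ homogeneous⇒fully-symmetric G enum
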